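{- For any graph $G$ and any edge $e\in E(G)$, $\mathrm{adim}(G)-1\le\mathrm{adim}(G-e)\le\mathrm{adim}(G)+1$.
   Context: All graphs are finite, simple and undirected; $G-e$ is the graph obtained from $G$ by deleting the edge $e$. For vertices $x,y$ of a graph $H$, $d(x,y)$ is the length of a shortest $x$–$y$ path in $H$ ($\infty$ if in different components) and $d_1(x,y)=\min\{d(x,y),2\}$. A set $S\subseteq V(H)$ is an adjacency resolving set of $H$ if for any two distinct $x,y$ there is $z\in S$ with $d_1(x,z)\neq d_1(y,z)$; $\mathrm{adim}(H)$ is the minimum cardinality of an adjacency resolving set of $H$. -}

module Defs where

open import Data.Nat using (ℕ; _≤_)
open import Data.Bool using (Bool; true; false; _∧_; _∨_; not; if_then_else_)
open import Data.Fin using (Fin)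
open import Data.Fin.Properties using (_≟_)
open import Data.Fin.Subset using (Subset; _∈_; ∣_∣)
open import Data.Product using (Σ; _×_; ∃)
open import Relation.Nullary using (¬_)
open import Relation.Nullary.Decidable using (⌊_⌋)
open import Relation.Binary.PropositionalEquality using (_≡_)

record Graph (n : ℕ) : Set where
  field
    adj    : Fin n → Fin n → Bool
    sym    : ∀ x y → adj x y ≡ adj y x
    irrefl : ∀ x → adj x x ≡ false
open Graph public

IsEdge : ∀ {n} → Graph n → Fin n → Fin n → Set
IsEdge G u v = adj G u v ≡ true

sameEdge : ∀ {n} → Fin n → Fin n → Fin n → Fin n → Bool
sameEdge u v x y = (⌊ x ≟ u ⌋ ∧ ⌊ y ≟ v ⌋) ∨ (⌊ x ≟ v ⌋ ∧ ⌊ y ≟ u ⌋)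

deleteEdge : ∀ {n} → Graph n → Fin n → Fin n → Graph n
deleteEdge {n} G u v = record
  { adj = λ x y → adj G x y ∧ not (sameEdge u v x y)
  ; sym = symP
  ; irrefl = irr
  }
  where
  open import Relation.Binary.PropositionalEquality using (cong₂; refl)
  open import Data.Bool.Properties using (∨-comm)
  sE : ∀ x y → sameEdge u v x y ≡ sameEdge u v y x
  sE x y with x ≟ u | y ≟ v | x ≟ v | y ≟ u
  ... | Relation.Nullary.yes _ | Relation.Nullary.yes _ | Relation.Nullary.yes _ | Relation.Nullary.yes _ = refl
  ... | Relation.Nullary.yes _ | Relation.Nullary.yes _ | Relation.Nullary.yes _ | Relation.Nullary.no _ = refl
  ... | Relation.Nullary.yes _ | Relation.Nullary.yes _ | Relation.Nullary.no _ | Relation.Nullary.yes _ = refl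
  ... | Relation.Nullary.yes _ | Relation.Nullary.yes _ | Relation.Nullary.no _ | Relation.Nullary.no _ = refl
  ... | Relation.Nullary.yes _ | Relation.Nullary.no _ | Relation.Nullary.yes _ | Relation.Nullary.yes _ = refl
  ... | Relation.Nullary.yes _ | Relation.Nullary.no _ | Relation.Nullary.yes _ | Relation.Nullary.no _ = refl
  ... | Relation.Nullary.yes _ | Relation.Nullary.no _ | Relation.Nullary.no _ | Relation.Nullary.yes _ = refl
  ... | Relation.Nullary.yes _ | Relation.Nullary.no _ | Relation.Nullary.no _ | Relation.Nullary.no _ = refl
  ... | Relation.Nullary.no _ | Relation.Nullary.yes _ | Relation.Nullary.yes _ | Relation.Nullary.yes _ = refl
  ... | Relation.Nullary.no _ | Relation.Nullary.yes _ | Relation.Nullary.yes _ | Relation.Nullary.no _ = refl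
  ... | Relation.Nullary.no _ | Relation.Nullary.yes _ | Relation.Nullary.no _ | Relation.Nullary.yes _ = refl
  ... | Relation.Nullary.no _ | Relation.Nullary.yes _ | Relation.Nullary.no _ | Relation.Nullary.no _ = refl
  ... | Relation.Nullary.no _ | Relation.Nullary.no _ | Relation.Nullary.yes _ | Relation.Nullary.yes _ = refl
  ... | Relation.Nullary.no _ | Relation.Nullary.no _ | Relation.Nullary.yes _ | Relation.Nullary.no _ = refl
  ... | Relation.Nullary.no _ | Relation.Nullary.no _ | Relation.Nullary.no _ | Relation.Nullary.yes _ = refl
  ... | Relation.Nullary.no _ | Relation.Nullary.no _ | Relation.Nullary.no _ | Relation.Nullary.no _ = refl
  symP : ∀ x y → (adj G x y ∧ not (sameEdge u v x y)) ≡ (adj G y x ∧ not (sameEdge u v y x))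
  symP x y = cong₂ (λ a b → a ∧ not b) (Graph.sym G x y) (sE x y)
  irr : ∀ x → (adj G x x ∧ not (sameEdge u v x x)) ≡ false
  irr x = cong₂ _∧_ (irrefl G x) (refl {x = not (sameEdge u v x x)})

-- d₁(x,y) = min{d(x,y), 2}: d(x,y)=0 iff x=y, d(x,y)=1 iff x,y adjacent,
-- otherwise d(x,y) ≥ 2 (possibly ∞), so min{d,2} = 2.
d₁ : ∀ {n} → Graph n → Fin n → Fin n → ℕ
d₁ G x y with x ≟ y
... | Relation.Nullary.yes _ = 0
... | Relation.Nullary.no _ = if adj G x y then 1 else 2

IsAdjResolving : ∀ {n} → Graph n → Subset n → Set
IsAdjResolving {n} G S =
  ∀ (x y : Fin n) → ¬ (x ≡ y) → ∃ λ z → z ∈ S × ¬ (d₁ G x z ≡ d₁ G y z)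

IsAdim : ∀ {n} → Graph n → ℕ → Set
IsAdim {n} G k =
  (∃ λ (S : Subset n) → IsAdjResolving G S × ∣ S ∣ ≡ k) ×
  (∀ (S : Subset n) → IsAdjResolving G S → k ≤ ∣ S ∣)

module Submission where

-- The proof never uses that uv is an edge of G: it only uses that G and
-- G - uv have the same adjacency except possibly on the pair {u , v}
-- ("G and H agree off {u , v}", a symmetric relation).  For such G, H:
--
--   * an adjacency resolving set S of G becomes one of H as soon as we add
--     the partner of each endpoint of uv lying in S: a vertex z that
--     separated x from y in G still does so in H unless {x , z} = {u , v},
--     and then x itself (now in the set) separates x from y;
--   * one added vertex suffices, giving a resolving set of H of size at
--     most |S| + 1, hence adim(H) ≤ adim(G) + 1.
--
-- Applying this to (G , G - uv) and to (G - uv , G) yields both bounds.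

open import Defs hiding (sym)
open import Data.Nat using (ℕ; _≤_; _+_; _∸_; suc; s≤s)
open import Data.Nat.Properties using (≤-refl; ≤-trans; n≤1+n; +-monoʳ-≤; +-suc; +-comm; m≤n+o⇒m∸n≤o)
open import Data.Fin using (Fin)
open import Data.Fin.Properties using (_≟_)
open import Data.Fin.Subset using (Subset; _∈_; _⊆_; _∪_; ⁅_⁆; ∣_∣)
open import Data.Fin.Subset.Properties using (_∈?_; x∈⁅x⁆; p⊆p∪q; q⊆p∪q; ∣⁅x⁆∣≡1)
open import Data.Vec using ([]; _∷_)
open import Data.Product using (Σ-syntax; _×_; _,_)
open import Data.Sum using (_⊎_; inj₁; inj₂)
open import Data.Bool using (true; false; if_then_else_)
open import Data.Bool.Properties using (∧-identityʳ)
open import Data.Empty using (⊥-elim)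
open import Relation.Nullary using (¬_; yes; no)
open import Relation.Binary.PropositionalEquality
  using (_≡_; _≢_; refl; sym; trans; cong; subst; ≢-sym)

∣p∪q∣≤∣p∣+∣q∣ : ∀ {n} (p q : Subset n) → ∣ p ∪ q ∣ ≤ ∣ p ∣ + ∣ q ∣
∣p∪q∣≤∣p∣+∣q∣ []          []          = ≤-refl
∣p∪q∣≤∣p∣+∣q∣ (true  ∷ p) (true  ∷ q) =
  s≤s (≤-trans (∣p∪q∣≤∣p∣+∣q∣ p q) (+-monoʳ-≤ ∣ p ∣ (n≤1+n ∣ q ∣)))
∣p∪q∣≤∣p∣+∣q∣ (true  ∷ p) (false ∷ q) = s≤s (∣p∪q∣≤∣p∣+∣q∣ p q)
∣p∪q∣≤∣p∣+∣q∣ (false ∷ p) (true  ∷ q) =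
  subst (suc ∣ p ∪ q ∣ ≤_) (sym (+-suc ∣ p ∣ ∣ q ∣)) (s≤s (∣p∪q∣≤∣p∣+∣q∣ p q))
∣p∪q∣≤∣p∣+∣q∣ (false ∷ p) (false ∷ q) = ∣p∪q∣≤∣p∣+∣q∣ p q

∣p∪⁅x⁆∣≤∣p∣+1 : ∀ {n} (p : Subset n) (x : Fin n) → ∣ p ∪ ⁅ x ⁆ ∣ ≤ ∣ p ∣ + 1
∣p∪⁅x⁆∣≤∣p∣+1 p x = subst (∣ p ∪ ⁅ x ⁆ ∣ ≤_) (cong (∣ p ∣ +_) (∣⁅x⁆∣≡1 x)) (∣p∪q∣≤∣p∣+∣q∣ p ⁅ x ⁆)

Separates : ∀ {n} → Graph n → Fin n → Fin n → Fin n → Set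
Separates H z x y = ¬ (d₁ H x z ≡ d₁ H y z)

separates-sym : ∀ {n} (H : Graph n) (z x y : Fin n) → Separates H z x y → Separates H z y x
separates-sym H z x y sep eq = sep (sym eq)

d₁-self : ∀ {n} (H : Graph n) (x : Fin n) → d₁ H x x ≡ 0
d₁-self H x with x ≟ x
... | yes _   = refl
... | no x≢x = ⊥-elim (x≢x refl)

d₁-distinct : ∀ {n} (H : Graph n) {y x : Fin n} → y ≢ x → d₁ H y x ≢ 0
d₁-distinct H {y} {x} y≢x with y ≟ x
... | yes y≡x = ⊥-elim (y≢x y≡x)
... | no _ with adj H y x
...   | true  = λ ()
...   | false = λ ()

-- Every vertex separates itself from any other vertex, being the only
-- vertex at truncated distance 0 from itself.
self-separates : ∀ {n} (H : Graph n) {x y : Fin n} → x ≢ y → Separates H x x y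
self-separates H {x} x≢y eq = d₁-distinct H (≢-sym x≢y) (trans (sym eq) (d₁-self H x))

d₁-local : ∀ {n} (G H : Graph n) (x z : Fin n) → adj G x z ≡ adj H x z → d₁ G x z ≡ d₁ H x z
d₁-local G H x z same with x ≟ z
... | yes _ = refl
... | no _  = cong (λ b → if b then 1 else 2) same

OnPair : ∀ {n} → Fin n → Fin n → Fin n → Fin n → Set
OnPair u v x z = (x ≡ u × z ≡ v) ⊎ (x ≡ v × z ≡ u)

AgreeOff : ∀ {n} → Graph n → Graph n → Fin n → Fin n → Set
AgreeOff G H u v = ∀ x z → adj G x z ≡ adj H x z ⊎ OnPair u v x z

agreeOff-sym : ∀ {n} (G H : Graph n) {u v : Fin n} → AgreeOff G H u v → AgreeOff H G u v
agreeOff-sym G H agree x z with agree x z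
... | inj₁ same   = inj₁ (sym same)
... | inj₂ onPair = inj₂ onPair

sameEdge-sound : ∀ {n} (u v x z : Fin n) → sameEdge u v x z ≡ true → OnPair u v x z
sameEdge-sound u v x z hit with x ≟ u | z ≟ v | x ≟ v | z ≟ u
... | yes x≡u | yes z≡v | _      | _      = inj₁ (x≡u , z≡v)
... | _       | _       | yes x≡v | yes z≡u = inj₂ (x≡v , z≡u)
sameEdge-sound u v x z () | no _  | _    | no _  | _
sameEdge-sound u v x z () | yes _ | no _ | no _  | _
sameEdge-sound u v x z () | no _  | _    | yes _ | no _
sameEdge-sound u v x z () | yes _ | no _ | yes _ | no _

agreeOff-deleteEdge : ∀ {n} (G : Graph n) (u v : Fin n) → AgreeOff G (deleteEdge G u v) u v
agreeOff-deleteEdge G u v x z with sameEdge u v x z in hit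
... | false = inj₁ (sym (∧-identityʳ (adj G x z)))
... | true  = inj₂ (sameEdge-sound u v x z hit)

Covers : ∀ {n} → Fin n → Fin n → Subset n → Subset n → Set
Covers u v S T = ∀ {x z} → OnPair u v x z → z ∈ S → x ∈ T

resolving-transfer : ∀ {n} {G H : Graph n} {u v : Fin n} → AgreeOff G H u v →
  {S T : Subset n} → S ⊆ T → Covers u v S T →
  IsAdjResolving G S → IsAdjResolving H T
resolving-transfer {G = G} {H} agree S⊆T cover resolves x y x≢y with resolves x y x≢y
... | z , z∈S , sep with agree x z | agree y z
...   | inj₂ xz  | _        = x , cover xz z∈S , self-separates H x≢y
...   | inj₁ _   | inj₂ yz  = y , cover yz z∈S , separates-sym H y y x (self-separates H (≢-sym x≢y))
...   | inj₁ sx  | inj₁ sy  = z , S⊆T z∈S , λ eq →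
  sep (trans (d₁-local G H x z sx) (trans eq (sym (d₁-local G H y z sy))))

coveringVertex : ∀ {n} (u v : Fin n) (S : Subset n) → Σ[ w ∈ Fin n ] Covers u v S (S ∪ ⁅ w ⁆)
coveringVertex u v S with u ∈? S
... | yes u∈S = v , λ where
  (inj₁ (refl , refl)) _ → p⊆p∪q ⁅ v ⁆ u∈S
  (inj₂ (refl , refl)) _ → q⊆p∪q S ⁅ v ⁆ (x∈⁅x⁆ v)
... | no u∉S = u , λ where
  (inj₁ (refl , refl)) _   → q⊆p∪q S ⁅ u ⁆ (x∈⁅x⁆ u)
  (inj₂ (refl , refl)) u∈S → ⊥-elim (u∉S u∈S)

adim-agreeOff : ∀ {n} {G H : Graph n} {u v : Fin n} → AgreeOff G H u v →
  ∀ {a b} → IsAdim G a → IsAdim H b → b ≤ a + 1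
adim-agreeOff {u = u} {v} agree ((S , resolves , refl) , _) (_ , minimal)
  with coveringVertex u v S
... | w , cover =
  ≤-trans (minimal (S ∪ ⁅ w ⁆) (resolving-transfer agree (p⊆p∪q ⁅ w ⁆) cover resolves))
          (∣p∪⁅x⁆∣≤∣p∣+1 S w)

theorem6p7 : ∀ {n} (G : Graph n) (u v : Fin n) → IsEdge G u v →
    ∀ (a b : ℕ) → IsAdim G a → IsAdim (deleteEdge G u v) b →
    (a ∸ 1 ≤ b) × (b ≤ a + 1)
theorem6p7 G u v _ a b adimG adimG-e = lower , upper
  where
  agree : AgreeOff G (deleteEdge G u v) u v
  agree = agreeOff-deleteEdge G u v

  upper : b ≤ a + 1
  upper = adim-agreeOff agree adimG adimG-e

  lower : a ∸ 1 ≤ b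
  lower = m≤n+o⇒m∸n≤o a 1
    (subst (a ≤_) (+-comm b 1) (adim-agreeOff (agreeOff-sym G (deleteEdge G u v) agree) adimG-e adimG))
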